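{- Let $C$ be a positive integer and let $S$ be a finite set of integer triples that contains no collapsible collection of size $C$. Then $S$ contains a 2-comparable subset of size at least $C^{ -3}|S|$.
   Context: For integer triples $a,b$, write $a<_2b$ if $a_i<b_i$ for at least two indices $i\in\{1,2,3\}$; two triples are 2-comparable if one is 2-less than the other, and a set of triples is 2-comparable if any two distinct elements are 2-comparable. For integer pairs, $(a_1,a_2)$ and $(b_1,b_2)$ are 2-comparable if either $a_1<b_1$ and $a_2<b_2$, or $b_1<a_1$ and $b_2<a_2$. A collection $H$ of integer triples is collapsible if all its elements lie in one of the planes $\{(x,*,*)\}$, $\{(*,y,*)\}$ or $\{(*,*,z)\}$ (i.e. they all share a fixed value in one coordinate) and, after projecting $H$ onto the two remaining (free) coordinates, no two elements of the resulting set of pairs are 2-comparable. -}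

module Defs where

open import Data.Integer using (ℤ; _<_)
open import Data.Product using (_×_; _,_; ∃; ∃-syntax)
open import Data.Sum using (_⊎_)
open import Data.Nat using (ℕ)
open import Data.Fin using (Fin)
open import Data.List using (List; length)
open import Data.List.Membership.Propositional using (_∈_)
open import Data.List.Relation.Unary.Unique.Propositional using (Unique)
open import Data.List.Relation.Binary.Subset.Propositional using (_⊆_)
open import Relation.Binary.PropositionalEquality using (_≡_; _≢_)

Triple : Set
Triple = ℤ × ℤ × ℤ

Pair : Set
Pair = ℤ × ℤ

coord : Fin 3 → Triple → ℤ
coord Fin.zero (x , _ , _) = x
coord (Fin.suc Fin.zero) (_ , y , _) = y
coord (Fin.suc (Fin.suc Fin.zero)) (_ , _ , z) = z

_<₂_ : Triple → Triple → Set
(a₁ , a₂ , a₃) <₂ (b₁ , b₂ , b₃) =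
  ((a₁ < b₁) × (a₂ < b₂)) ⊎ ((a₁ < b₁) × (a₃ < b₃)) ⊎ ((a₂ < b₂) × (a₃ < b₃))

TwoComparable₃ : Triple → Triple → Set
TwoComparable₃ a b = (a <₂ b) ⊎ (b <₂ a)

IsTwoComparableSet : List Triple → Set
IsTwoComparableSet T = ∀ {a b} → a ∈ T → b ∈ T → a ≢ b → TwoComparable₃ a b

TwoComparable₂ : Pair → Pair → Set
TwoComparable₂ (a₁ , a₂) (b₁ , b₂) = ((a₁ < b₁) × (a₂ < b₂)) ⊎ ((b₁ < a₁) × (b₂ < a₂))

project : Fin 3 → Triple → Pair
project Fin.zero (_ , y , z) = (y , z)
project (Fin.suc Fin.zero) (x , _ , z) = (x , z)
project (Fin.suc (Fin.suc Fin.zero)) (x , y , _) = (x , y)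

Collapsible : List Triple → Set
Collapsible H = ∃[ i ] ∃[ v ]
  ((∀ {h} → h ∈ H → coord i h ≡ v) ×
   (∀ {a b} → a ∈ H → b ∈ H → project i a ≢ project i b →
      TwoComparable₂ (project i a) (project i b) → ⊥))
  where open import Data.Empty using (⊥)

SubsetOf : List Triple → List Triple → Set
SubsetOf H S = Unique H × H ⊆ S

-- For each plane direction i, let a ≺⟨ i ⟩ b mean that a and b share their i-th coordinate and
-- their projections (x₁ , x₂), (y₁ , y₂) satisfy x₁ ≤ y₁, y₂ ≤ x₂ and differ. Two distinct
-- coplanar points fail to be 2-comparable exactly when they are ≺⟨ i ⟩-related, so every
-- ≺⟨ i ⟩-chain in S is collapsible and hence has fewer than C elements. The height of a point in
-- each of the three orders is therefore below C, and pigeonholing on the three heights leaves at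
-- least |S|/C³ points with equal heights. Any two of them are incomparable in all three orders,
-- and a case analysis on which coordinates agree shows that such points are 2-comparable.

module Submission where

open import Defs
open import Data.Nat using (ℕ; zero; suc; _+_; _*_; _^_; _≤_; _<_; z≤n; s≤s; _≟_; _≤?_)
open import Data.Nat.Properties
  using (≤-reflexive; ≤-trans; ≤-total; ≤-pred; <⇒≤; <⇒≱; ≰⇒>; <-irrefl; ≤∧≢⇒<;
         +-suc; +-identityʳ; *-assoc; +-monoˡ-≤; +-monoʳ-≤; *-monoʳ-≤; module ≤-Reasoning)
open import Data.Integer as ℤ using (ℤ)
import Data.Integer.Properties as ℤ
open import Data.Fin using (Fin; zero; suc)
open import Data.List using (List; []; _∷_; length; filter; map)
open import Data.List.Extrema.Nat using (max; xs≤max; max≤v⁺)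
open import Data.List.Membership.Propositional using (_∈_; find; lose)
open import Data.List.Membership.Propositional.Properties using (∈-filter⁻; ∈-filter⁺; ∈-map⁺; ∈-AllPairs₂)
open import Data.List.Relation.Unary.All as All using (All; []; _∷_)
open import Data.List.Relation.Unary.All.Properties using () renaming (map⁺ to All-map⁺)
open import Data.List.Relation.Unary.AllPairs as AllPairs using (AllPairs; _∷_)
open import Data.List.Relation.Unary.Any using (any?; here; there)
open import Data.List.Relation.Unary.Linked using (Linked; [-]; _∷_)
open import Data.List.Relation.Unary.Linked.Properties using (Linked⇒AllPairs)
open import Data.List.Relation.Unary.Unique.Propositional using (Unique)
open import Data.List.Relation.Unary.Unique.Propositional.Properties using () renaming (filter⁺ to Unique-filter⁺)
open import Data.List.Relation.Binary.Sublist.Propositional.Properties using (filter⁺; filter-⊆; length-mono-≤)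
open import Data.Product using (_×_; _,_; proj₁; proj₂; ∃-syntax)
open import Data.Product.Properties using (≡-dec)
open import Data.Sum using (_⊎_; inj₁; inj₂)
open import Function using (_∘_; flip)
open import Relation.Binary using (Decidable; tri<; tri≈; tri>)
open import Relation.Nullary using (¬_; yes; no; ¬?; contradiction)
open import Relation.Nullary.Decidable using (_×-dec_)
import Relation.Unary as U
open import Relation.Unary.Properties using (∁?)
open import Relation.Binary.PropositionalEquality using (_≡_; _≢_; refl; sym; trans; cong; cong₂)

module _ {A : Set} {P : A → Set} (P? : U.Decidable P) where

  length-filter+length-filter-∁ : ∀ xs → length (filter P? xs) + length (filter (∁? P?) xs) ≡ length xs
  length-filter+length-filter-∁ [] = refl
  length-filter+length-filter-∁ (x ∷ xs) with P? x
  ... | yes _ = cong suc (length-filter+length-filter-∁ xs)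
  ... | no _ = trans (+-suc _ _) (cong suc (length-filter+length-filter-∁ xs))

module _ {A : Set} (g : A → ℕ) where

  fibre : ℕ → List A → List A
  fibre k = filter (λ x → g x ≟ k)

  ∈-fibre⁻ : ∀ k xs {x} → x ∈ fibre k xs → x ∈ xs × g x ≡ k
  ∈-fibre⁻ k xs = ∈-filter⁻ (λ x → g x ≟ k)

  fibre-mono : ∀ {Q : A → Set} (Q? : U.Decidable Q) k xs →
               length (fibre k (filter Q? xs)) ≤ length (fibre k xs)
  fibre-mono Q? k xs = length-mono-≤ (filter⁺ _ _ (λ { refl gx≡k → gx≡k }) (filter-⊆ Q? xs))

  pigeonhole : ∀ n xs → (∀ {x} → x ∈ xs → g x < n) → ∃[ k ] length xs ≤ n * length (fibre k xs)
  pigeonhole zero [] _ = 0 , z≤n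
  pigeonhole zero (x ∷ xs) bound with () ← bound (here refl)
  pigeonhole (suc n) xs bound = choose (≤-total (length (fibre n xs)) (length (fibre k xs)))
    where
    rest = filter (∁? (λ x → g x ≟ n)) xs

    rest-bound : ∀ {x} → x ∈ rest → g x < n
    rest-bound x∈ = let x∈xs , gx≢n = ∈-filter⁻ (∁? (λ x → g x ≟ n)) x∈ in
      ≤∧≢⇒< (≤-pred (bound x∈xs)) gx≢n

    k = proj₁ (pigeonhole n rest rest-bound)

    split : length xs ≤ length (fibre n xs) + n * length (fibre k xs)
    split = begin
      length xs                                       ≡⟨ length-filter+length-filter-∁ (λ x → g x ≟ n) xs ⟨
      length (fibre n xs) + length rest               ≤⟨ +-monoʳ-≤ _ (proj₂ (pigeonhole n rest rest-bound)) ⟩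
      length (fibre n xs) + n * length (fibre k rest) ≤⟨ +-monoʳ-≤ _ (*-monoʳ-≤ n (fibre-mono _ k xs)) ⟩
      length (fibre n xs) + n * length (fibre k xs)   ∎
      where open ≤-Reasoning

    choose : length (fibre n xs) ≤ length (fibre k xs) ⊎ length (fibre k xs) ≤ length (fibre n xs) →
             ∃[ k ] length xs ≤ suc n * length (fibre k xs)
    choose (inj₁ n≤k) = k , ≤-trans split (+-monoˡ-≤ _ n≤k)
    choose (inj₂ k≤n) = n , ≤-trans split (+-monoʳ-≤ _ (*-monoʳ-≤ n k≤n))

iteratedPigeonhole : ∀ {A : Set} n m (g : Fin m → A → ℕ) xs → (∀ i {x} → x ∈ xs → g i x < n) →
  ∃[ ys ] (∀ {y} → y ∈ ys → y ∈ xs) × (Unique xs → Unique ys) ×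
          (∀ i {a b} → a ∈ ys → b ∈ ys → g i a ≡ g i b) × length xs ≤ n ^ m * length ys
iteratedPigeonhole n zero g xs _ =
  xs , (λ x∈ → x∈) , (λ xs-unique → xs-unique) , (λ ()) , ≤-reflexive (sym (+-identityʳ _))
iteratedPigeonhole n (suc m) g xs bound
  with k , |xs|≤n|ys| ← pigeonhole (g zero) n xs (bound zero)
  with zs , zs⊆ys , zs-unique , sameValues , |ys|≤nᵐ|zs| ←
         iteratedPigeonhole n m (g ∘ suc) (fibre (g zero) k xs)
           (λ i y∈ → bound (suc i) (proj₁ (∈-fibre⁻ (g zero) k xs y∈)))
  = zs , proj₁ ∘ ∈-ys⁻ ∘ zs⊆ys , zs-unique ∘ Unique-filter⁺ _ , sameValues′ , |xs|≤nᵐ⁺¹|zs|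
  where
  ∈-ys⁻ : ∀ {y} → y ∈ fibre (g zero) k xs → y ∈ xs × g zero y ≡ k
  ∈-ys⁻ = ∈-fibre⁻ (g zero) k xs

  sameValues′ : ∀ i {a b} → a ∈ zs → b ∈ zs → g i a ≡ g i b
  sameValues′ zero    a∈ b∈ = trans (proj₂ (∈-ys⁻ (zs⊆ys a∈))) (sym (proj₂ (∈-ys⁻ (zs⊆ys b∈))))
  sameValues′ (suc i) = sameValues i

  |xs|≤nᵐ⁺¹|zs| : length xs ≤ n ^ suc m * length zs
  |xs|≤nᵐ⁺¹|zs| = begin
    length xs                            ≤⟨ |xs|≤n|ys| ⟩
    n * length (fibre (g zero) k xs)     ≤⟨ *-monoʳ-≤ n |ys|≤nᵐ|zs| ⟩
    n * (n ^ m * length zs)              ≡⟨ *-assoc n (n ^ m) (length zs) ⟨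
    n ^ suc m * length zs                ∎
    where open ≤-Reasoning

module Height {A : Set} {_≺_ : A → A → Set} (_≺?_ : Decidable _≺_) (S : List A) where

  -- Length of the longest descending ≺-chain in S below p, cut off at the fuel n; it stops
  -- growing with n as soon as it is smaller than n (height-stable).
  height : ℕ → A → ℕ
  height zero    p = 0
  height (suc n) p = max 0 (map (λ q → suc (height n q)) (filter (_≺? p) S))

  height-suc-≥ : ∀ {n p q} → q ∈ S → q ≺ p → suc (height n q) ≤ height (suc n) p
  height-suc-≥ {n} {p} q∈S q≺p =
    All.lookup (xs≤max 0 _) (∈-map⁺ (λ q → suc (height n q)) (∈-filter⁺ (_≺? p) q∈S q≺p))

  height-suc-≤ : ∀ {n p m} → (∀ {q} → q ∈ S → q ≺ p → suc (height n q) ≤ m) → height (suc n) p ≤ m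
  height-suc-≤ {p = p} below = max≤v⁺ z≤n (All-map⁺ (All.tabulate λ q∈ →
    let q∈S , q≺p = ∈-filter⁻ (_≺? p) q∈ in below q∈S q≺p))

  height-suc-witness : ∀ {n p k} → suc k ≤ height (suc n) p → ∃[ q ] q ∈ S × q ≺ p × k ≤ height n q
  height-suc-witness {n} {p} {k} k<h with any? (λ q → k ≤? height n q) (filter (_≺? p) S)
  ... | yes some = let q , q∈ , k≤hq = find some ; q∈S , q≺p = ∈-filter⁻ (_≺? p) q∈ in
    q , q∈S , q≺p , k≤hq
  ... | no none = contradiction k<h (<⇒≱ (s≤s (height-suc-≤ {n} λ q∈S q≺p →
    ≰⇒> λ k≤hq → none (lose (∈-filter⁺ (_≺? p) q∈S q≺p) k≤hq))))

  height-stable : ∀ {n p} → height n p < n → height (suc n) p ≤ height n p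
  height-stable {suc n} h<n = height-suc-≤ {suc n} λ q∈S q≺p →
    let hq<hp = height-suc-≥ {n} q∈S q≺p in
    ≤-trans (s≤s (height-stable (≤-trans hq<hp (≤-pred h<n)))) hq<hp

  height-strictMono : ∀ {n p q} → height n p < n → q ∈ S → q ≺ p → height n q < height n p
  height-strictMono {n} h<n q∈S q≺p = ≤-trans (height-suc-≥ {n} q∈S q≺p) (height-stable h<n)

  descendingChain : ∀ n p {k} → k ≤ height n p →
                    ∃[ qs ] length qs ≡ k × All (_∈ S) qs × Linked (flip _≺_) (p ∷ qs)
  descendingChain n p {zero} _ = [] , refl , [] , [-]
  descendingChain (suc n) p {suc k} k<h with height-suc-witness {n} k<h
  ... | q , q∈S , q≺p , k≤hq with descendingChain n q k≤hq
  ...   | qs , refl , qs⊆S , chain = q ∷ qs , refl , q∈S ∷ qs⊆S , q≺p ∷ chain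

_◁_ : Pair → Pair → Set
(x₁ , x₂) ◁ (y₁ , y₂) = (x₁ , x₂) ≢ (y₁ , y₂) × x₁ ℤ.≤ y₁ × y₂ ℤ.≤ x₂

_◁?_ : Decidable _◁_
(x₁ , x₂) ◁? (y₁ , y₂) = ¬? (≡-dec ℤ._≟_ ℤ._≟_ (x₁ , x₂) (y₁ , y₂)) ×-dec (x₁ ℤ.≤? y₁) ×-dec (y₂ ℤ.≤? x₂)

◁-trans : ∀ {x y z} → x ◁ y → y ◁ z → x ◁ z
◁-trans (x≢y , x₁≤y₁ , y₂≤x₂) (_ , y₁≤z₁ , z₂≤y₂) =
  (λ { refl → x≢y (cong₂ _,_ (ℤ.≤-antisym x₁≤y₁ y₁≤z₁) (ℤ.≤-antisym z₂≤y₂ y₂≤x₂)) }) ,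
  ℤ.≤-trans x₁≤y₁ y₁≤z₁ , ℤ.≤-trans z₂≤y₂ y₂≤x₂

◁⇒¬TwoComparable₂ : ∀ {x y} → x ◁ y → ¬ TwoComparable₂ x y
◁⇒¬TwoComparable₂ (_ , _ , y₂≤x₂) (inj₁ (_ , x₂<y₂)) = ℤ.<⇒≱ x₂<y₂ y₂≤x₂
◁⇒¬TwoComparable₂ (_ , x₁≤y₁ , _) (inj₂ (y₁<x₁ , _)) = ℤ.<⇒≱ y₁<x₁ x₁≤y₁

TwoComparable₂-sym : ∀ {x y} → TwoComparable₂ x y → TwoComparable₂ y x
TwoComparable₂-sym (inj₁ x<y) = inj₂ x<y
TwoComparable₂-sym (inj₂ y<x) = inj₁ y<x

≢⇒TwoComparable₂⊎◁ : ∀ {x y} → x ≢ y → TwoComparable₂ x y ⊎ x ◁ y ⊎ y ◁ x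
≢⇒TwoComparable₂⊎◁ {x₁ , x₂} {y₁ , y₂} x≢y with ℤ.<-cmp x₁ y₁
... | tri< x₁<y₁ _ _ with x₂ ℤ.<? y₂
...   | yes x₂<y₂ = inj₁ (inj₁ (x₁<y₁ , x₂<y₂))
...   | no  x₂≮y₂ = inj₂ (inj₁ (x≢y , ℤ.<⇒≤ x₁<y₁ , ℤ.≮⇒≥ x₂≮y₂))
≢⇒TwoComparable₂⊎◁ {x₁ , x₂} {y₁ , y₂} x≢y | tri> _ _ y₁<x₁ with y₂ ℤ.<? x₂
...   | yes y₂<x₂ = inj₁ (inj₂ (y₁<x₁ , y₂<x₂))
...   | no  y₂≮x₂ = inj₂ (inj₂ (x≢y ∘ sym , ℤ.<⇒≤ y₁<x₁ , ℤ.≮⇒≥ y₂≮x₂))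
≢⇒TwoComparable₂⊎◁ {x₁ , x₂} {y₁ , y₂} x≢y | tri≈ _ refl _ with y₂ ℤ.≤? x₂
...   | yes y₂≤x₂ = inj₂ (inj₁ (x≢y , ℤ.≤-refl , y₂≤x₂))
...   | no  y₂≰x₂ = inj₂ (inj₂ (x≢y ∘ sym , ℤ.≤-refl , ℤ.<⇒≤ (ℤ.≰⇒> y₂≰x₂)))

_≺⟨_⟩_ : Triple → Fin 3 → Triple → Set
a ≺⟨ i ⟩ b = coord i a ≡ coord i b × project i a ◁ project i b

≺⟨_⟩? : ∀ i → Decidable (λ a b → a ≺⟨ i ⟩ b)
≺⟨ i ⟩? a b = (coord i a ℤ.≟ coord i b) ×-dec (project i a ◁? project i b)

≺-trans : ∀ i {a b c} → a ≺⟨ i ⟩ b → b ≺⟨ i ⟩ c → a ≺⟨ i ⟩ c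
≺-trans i (a≡b , a◁b) (b≡c , b◁c) = trans a≡b b≡c , ◁-trans a◁b b◁c

≺-irrefl : ∀ i {a} → ¬ a ≺⟨ i ⟩ a
≺-irrefl i (_ , a≢a , _) = a≢a refl

project-injective : ∀ i {a b} → coord i a ≡ coord i b → project i a ≡ project i b → a ≡ b
project-injective zero             refl refl = refl
project-injective (suc zero)       refl refl = refl
project-injective (suc (suc zero)) refl refl = refl

TwoComparable₂⇒TwoComparable₃ : ∀ i a b → TwoComparable₂ (project i a) (project i b) → TwoComparable₃ a b
TwoComparable₂⇒TwoComparable₃ zero             _ _ (inj₁ a<b) = inj₁ (inj₂ (inj₂ a<b))
TwoComparable₂⇒TwoComparable₃ zero             _ _ (inj₂ b<a) = inj₂ (inj₂ (inj₂ b<a))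
TwoComparable₂⇒TwoComparable₃ (suc zero)       _ _ (inj₁ a<b) = inj₁ (inj₂ (inj₁ a<b))
TwoComparable₂⇒TwoComparable₃ (suc zero)       _ _ (inj₂ b<a) = inj₂ (inj₂ (inj₁ b<a))
TwoComparable₂⇒TwoComparable₃ (suc (suc zero)) _ _ (inj₁ a<b) = inj₁ (inj₁ a<b)
TwoComparable₂⇒TwoComparable₃ (suc (suc zero)) _ _ (inj₂ b<a) = inj₂ (inj₁ b<a)

coplanar-incomparable⇒TwoComparable₃ : ∀ i {a b} → coord i a ≡ coord i b → a ≢ b →
  ¬ a ≺⟨ i ⟩ b → ¬ b ≺⟨ i ⟩ a → TwoComparable₃ a b
coplanar-incomparable⇒TwoComparable₃ i {a} {b} a≡b a≢b a⊀b b⊀a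
  with ≢⇒TwoComparable₂⊎◁ (a≢b ∘ project-injective i a≡b)
... | inj₁ tc         = TwoComparable₂⇒TwoComparable₃ i a b tc
... | inj₂ (inj₁ a◁b) = contradiction (a≡b , a◁b) a⊀b
... | inj₂ (inj₂ b◁a) = contradiction (sym a≡b , b◁a) b⊀a

≢⇒<⊎> : ∀ {x y : ℤ} → x ≢ y → x ℤ.< y ⊎ y ℤ.< x
≢⇒<⊎> {x} {y} x≢y with ℤ.<-cmp x y
... | tri< x<y _ _ = inj₁ x<y
... | tri≈ _ x≡y _ = contradiction x≡y x≢y
... | tri> _ _ y<x = inj₂ y<x

-- Of the three strict coordinate comparisons, two point the same way.
distinctCoords⇒TwoComparable₃ : ∀ {a₁ a₂ a₃ b₁ b₂ b₃} → a₁ ≢ b₁ → a₂ ≢ b₂ → a₃ ≢ b₃ →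
  TwoComparable₃ (a₁ , a₂ , a₃) (b₁ , b₂ , b₃)
distinctCoords⇒TwoComparable₃ a₁≢b₁ a₂≢b₂ a₃≢b₃ with ≢⇒<⊎> a₁≢b₁ | ≢⇒<⊎> a₂≢b₂ | ≢⇒<⊎> a₃≢b₃
... | inj₁ p | inj₁ q | _      = inj₁ (inj₁ (p , q))
... | inj₂ p | inj₂ q | _      = inj₂ (inj₁ (p , q))
... | inj₁ p | inj₂ _ | inj₁ r = inj₁ (inj₂ (inj₁ (p , r)))
... | inj₁ _ | inj₂ q | inj₂ r = inj₂ (inj₂ (inj₂ (q , r)))
... | inj₂ _ | inj₁ q | inj₁ r = inj₁ (inj₂ (inj₂ (q , r)))
... | inj₂ p | inj₁ _ | inj₂ r = inj₂ (inj₂ (inj₁ (p , r)))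

sharedCoord⊎distinctCoords : ∀ a₁ a₂ a₃ b₁ b₂ b₃ →
  (∃[ i ] coord i (a₁ , a₂ , a₃) ≡ coord i (b₁ , b₂ , b₃)) ⊎ (a₁ ≢ b₁ × a₂ ≢ b₂ × a₃ ≢ b₃)
sharedCoord⊎distinctCoords a₁ a₂ a₃ b₁ b₂ b₃ with a₁ ℤ.≟ b₁ | a₂ ℤ.≟ b₂ | a₃ ℤ.≟ b₃
... | yes a₁≡b₁ | _         | _         = inj₁ (zero , a₁≡b₁)
... | no _      | yes a₂≡b₂ | _         = inj₁ (suc zero , a₂≡b₂)
... | no _      | no _      | yes a₃≡b₃ = inj₁ (suc (suc zero) , a₃≡b₃)
... | no a₁≢b₁  | no a₂≢b₂  | no a₃≢b₃  = inj₂ (a₁≢b₁ , a₂≢b₂ , a₃≢b₃)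

incomparable⇒TwoComparable₃ : ∀ {a b} → a ≢ b → (∀ i → ¬ a ≺⟨ i ⟩ b) → (∀ i → ¬ b ≺⟨ i ⟩ a) →
  TwoComparable₃ a b
incomparable⇒TwoComparable₃ {a₁ , a₂ , a₃} {b₁ , b₂ , b₃} a≢b a⊀b b⊀a
  with sharedCoord⊎distinctCoords a₁ a₂ a₃ b₁ b₂ b₃
... | inj₁ (i , a≡b) = coplanar-incomparable⇒TwoComparable₃ i a≡b a≢b (a⊀b i) (b⊀a i)
... | inj₂ (a₁≢b₁ , a₂≢b₂ , a₃≢b₃) = distinctCoords⇒TwoComparable₃ a₁≢b₁ a₂≢b₂ a₃≢b₃

descending⇒Unique : ∀ i {xs} → AllPairs (λ a b → b ≺⟨ i ⟩ a) xs → Unique xs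
descending⇒Unique i = AllPairs.map λ { b≺a refl → ≺-irrefl i b≺a }

descending⇒Collapsible : ∀ i {p qs} → AllPairs (λ a b → b ≺⟨ i ⟩ a) (p ∷ qs) → Collapsible (p ∷ qs)
descending⇒Collapsible i {p} {qs} chain@(below ∷ _) = i , coord i p , sameCoord , noTwoComparable
  where
  sameCoord : ∀ {h} → h ∈ p ∷ qs → coord i h ≡ coord i p
  sameCoord (here refl) = refl
  sameCoord (there h∈)  = proj₁ (All.lookup below h∈)

  noTwoComparable : ∀ {a b} → a ∈ p ∷ qs → b ∈ p ∷ qs → project i a ≢ project i b →
                    ¬ TwoComparable₂ (project i a) (project i b)
  noTwoComparable a∈ b∈ pa≢pb with ∈-AllPairs₂ chain a∈ b∈
  ... | inj₁ refl       = contradiction refl pa≢pb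
  ... | inj₂ (inj₁ b≺a) = ◁⇒¬TwoComparable₂ (proj₂ b≺a) ∘ TwoComparable₂-sym
  ... | inj₂ (inj₂ a≺b) = ◁⇒¬TwoComparable₂ (proj₂ a≺b)

module NoCollapsibleOfSize (c : ℕ) (S : List Triple)
  (noCollapsible : ∀ H → SubsetOf H S → length H ≡ suc c → ¬ Collapsible H) where

  open module Heights (i : Fin 3) = Height ≺⟨ i ⟩? S

  h : Fin 3 → Triple → ℕ
  h i = height i (suc c)

  h-bounded : ∀ i {p} → p ∈ S → h i p < suc c
  h-bounded i {p} p∈S = ≰⇒> λ c<hp →
    let qs , |qs|≡c , qs⊆S , chain = descendingChain i (suc c) p (<⇒≤ c<hp)
        descending = Linked⇒AllPairs (λ b≺a c≺b → ≺-trans i c≺b b≺a) chain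
    in noCollapsible (p ∷ qs) (descending⇒Unique i descending , All.lookup (p∈S ∷ qs⊆S))
                     (cong suc |qs|≡c) (descending⇒Collapsible i descending)

  sameHeights⇒TwoComparable₃ : ∀ {a b} → a ∈ S → b ∈ S → a ≢ b → (∀ i → h i a ≡ h i b) →
                               TwoComparable₃ a b
  sameHeights⇒TwoComparable₃ a∈S b∈S a≢b ha≡hb = incomparable⇒TwoComparable₃ a≢b
    (λ i a≺b → <-irrefl (ha≡hb i) (height-strictMono i (h-bounded i b∈S) a∈S a≺b))
    (λ i b≺a → <-irrefl (sym (ha≡hb i)) (height-strictMono i (h-bounded i a∈S) b∈S b≺a))

lemma2p7 : (C : ℕ) → 1 ≤ C → (S : List Triple) → Unique S →
           (∀ H → SubsetOf H S → length H ≡ C → ¬ Collapsible H) →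
           ∃[ T ] (SubsetOf T S × IsTwoComparableSet T × length S ≤ C ^ 3 * length T)
lemma2p7 zero () _ _ _
lemma2p7 (suc c) _ S S-unique noCollapsible =
  let T , T⊆S , unique⇒T-unique , sameHeights , |S|≤C³|T| = iteratedPigeonhole (suc c) 3 h S h-bounded
  in T , (unique⇒T-unique S-unique , T⊆S) ,
     (λ a∈T b∈T a≢b → sameHeights⇒TwoComparable₃ (T⊆S a∈T) (T⊆S b∈T) a≢b λ i → sameHeights i a∈T b∈T) ,
     |S|≤C³|T|
  where open NoCollapsibleOfSize c S noCollapsible
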